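{- Let $G=([n],E)$ be a terrain-like graph and let $1\le x<y\le n$. If there is no edge $\{u,v\}\in E$ with $\{u,v\}\preceq\{x,y\}$, then $2x$ and $2y-1$ are in non-edge configuration in $\Pi(G)$.
   Context: $[n]=\{1,\dots,n\}$; $\mathcal{S}_{2n}$ is the symmetric group on $[2n]$, with product meaning composition, $(\sigma\rho)(x)=\sigma(\rho(x))$; $(a,b)$ denotes a transposition. A graph $G=([n],E)$ is terrain-like if for all $a<b<c<d$, $\{a,c\},\{b,d\}\in E$ implies $\{a,d\}\in E$. On $\binom{[n]}{2}$ define $\preceq$ by: for $a<b$, $c<d$, $\{a,b\}\preceq\{c,d\}$ iff $c\le a<b\le d$ (so $\preceq$ is reflexive). A valid ordering of $E$ is a total order $\le$ on $E$ with $e\preceq e'\Rightarrow e\le e'$. For $a<b$ let $\tau(\{a,b\})=(2a,2b-1)$ and $\pi_0=(1,2)(3,4)\cdots(2n-1,2n)$. For $E=\{e_1>\dots>e_m\}$ in a valid ordering, $\Pi(G)=\tau(e_m)\cdots\tau(e_1)\pi_0$ (independent of the valid ordering). For a permutation $\sigma\in\mathcal{S}_{2n}$ and $2\le i<j\le 2n-1$ with $i$ even and $j$ odd, $i$ and $j$ are in edge configuration in $\sigma$ if ($\sigma^{ -1}(i)<\sigma^{ -1}(j)$ iff $\sigma^{ -1}(i)\equiv\sigma^{ -1}(j)\pmod 2$); otherwise they are in non-edge configuration. -}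

module Defs where

open import Data.Nat using (ℕ; zero; suc; _+_; _*_; _∸_; _≤_; _<_; _≟_)
open import Data.Nat.DivMod using (_%_)
open import Data.Product using (_×_; _,_)
open import Data.Bool using (if_then_else_)
open import Data.List using (List; []; _∷_)
open import Data.List.Relation.Unary.All using (All)
open import Data.List.Relation.Unary.AllPairs using (AllPairs)
open import Data.List.Membership.Propositional using (_∈_)
open import Relation.Nullary using (¬_; does)
open import Relation.Binary.PropositionalEquality using (_≡_)
open import Function.Bundles using (_⇔_)

-- An edge {a,b} with a < b is represented by the ordered pair (a , b).
Edge : Set
Edge = ℕ × ℕ

WellFormedEdge : ℕ → Edge → Set
WellFormedEdge n (a , b) = 1 ≤ a × a < b × b ≤ n

_⪯_ : Edge → Edge → Set
(a , b) ⪯ (c , d) = c ≤ a × b ≤ d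

TerrainLike : List Edge → Set
TerrainLike es = ∀ a b c d → a < b → b < c → c < d →
  (a , c) ∈ es → (b , d) ∈ es → (a , d) ∈ es

-- A list es = [e₁ , e₂ , … , eₘ] lists the edge set E = {e₁ > e₂ > … > eₘ}
-- in decreasing order of a valid ordering ≤ iff for all i < j we do NOT
-- have eᵢ ⪯ eⱼ  (since eᵢ > eⱼ strictly, and validity says eᵢ ⪯ eⱼ ⇒ eᵢ ≤ eⱼ).
-- (Reflexivity of ⪯ makes this also force the eᵢ to be distinct.)
ValidDecreasing : List Edge → Set
ValidDecreasing es = AllPairs (λ e e′ → ¬ (e ⪯ e′)) es

-- Permutations of [2n] represented as functions ℕ → ℕ.
-- Transposition (a , b).
swap : ℕ → ℕ → ℕ → ℕ
swap a b x = if does (x ≟ a) then b else (if does (x ≟ b) then a else x)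

τ : Edge → ℕ → ℕ
τ (a , b) = swap (2 * a) (2 * b ∸ 1)

-- π₀ = (1,2)(3,4)⋯ : swaps 2k-1 and 2k  (0 is fixed; irrelevant).
π₀ : ℕ → ℕ
π₀ zero = zero
π₀ (suc zero) = 2
π₀ (suc (suc zero)) = 1
π₀ (suc (suc (suc k))) = 2 + π₀ (suc k)

applyAfter : List Edge → ℕ → ℕ
applyAfter [] x = x
applyAfter (e ∷ es) x = applyAfter es (τ e x)

-- Π(G) = τ(eₘ) ⋯ τ(e₁) π₀  for es = [e₁ , … , eₘ],  (σρ)(x) = σ(ρ(x)).
Π : List Edge → ℕ → ℕ
Π es x = applyAfter es (π₀ x)

-- i and j are in edge configuration in σ ∈ S_{2n}:
-- σ⁻¹(i) < σ⁻¹(j)  iff  σ⁻¹(i) ≡ σ⁻¹(j) (mod 2).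
-- σ⁻¹(i) is written as the (unique) p ∈ [2n] with σ p ≡ i.
EdgeConfig : ℕ → (ℕ → ℕ) → ℕ → ℕ → Set
EdgeConfig n σ i j = ∀ p q → 1 ≤ p → p ≤ 2 * n → 1 ≤ q → q ≤ 2 * n →
  σ p ≡ i → σ q ≡ j → (p < q) ⇔ (p % 2 ≡ q % 2)

NonEdgeConfig : ℕ → (ℕ → ℕ) → ℕ → ℕ → Set
NonEdgeConfig n σ i j = ∀ p q → 1 ≤ p → p ≤ 2 * n → 1 ≤ q → q ≤ 2 * n →
  σ p ≡ i → σ q ≡ j → ¬ ((p < q) ⇔ (p % 2 ≡ q % 2))

{-# OPTIONS --safe #-}
module Submission where

-- Pull the entries 2x and 2y − 1 back through τ(eₘ), τ(eₘ₋₁), …, τ(e₁) and π₀.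
-- A transposition τ({u,v}) only exchanges 2u and 2v − 1, so at every stage the
-- pair of entries has one of the shapes (2α, 2β−1), (2a−1, 2b−1), (2a, 2b),
-- (2a−1, 2b), subject to nesting conditions on the edges not yet removed
-- (State). The edge removed next is ⪯-minimal among them, and the terrain-like
-- property is what keeps the conditions alive after its removal. Once no edge
-- is left, π₀ turns each shape into two positions that are increasing with
-- different parities or decreasing with equal parities.

open import Defs
open import Data.Nat using (ℕ; zero; suc; _+_; _*_; _∸_; _≤_; _<_; _≟_; s≤s)
open import Data.Nat.Properties
open import Data.Nat.DivMod using (_%_; m*n%n≡0; [m+kn]%n≡m%n)
open import Data.Product using (_×_; _,_; proj₁; proj₂)
open import Data.Sum using (inj₁; inj₂)
open import Data.Empty using (⊥-elim)
open import Data.List using (List; []; _∷_; _∷ʳ_)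
open import Data.List.Reverse using (Reverse; []; _∶_∶ʳ_; reverseView)
open import Data.List.Relation.Unary.All using (All; []; _∷_)
import Data.List.Relation.Unary.All as All
open import Data.List.Relation.Unary.Any using (here)
open import Data.List.Relation.Unary.All.Properties using (++⁻ˡ; ++⁻ʳ; ++⁻)
open import Data.List.Relation.Unary.AllPairs using (AllPairs; []; _∷_)
open import Data.List.Membership.Propositional using (_∈_)
open import Data.List.Membership.Propositional.Properties using (∈-++⁺ˡ; ∈-++⁺ʳ; ∈-++⁻)
open import Relation.Nullary using (¬_; yes; no)
open import Relation.Nullary.Decidable using (dec-true; dec-false)
open import Relation.Binary.PropositionalEquality
open import Function.Bundles using (_⇔_; Equivalence)

odd : ℕ → ℕ
odd b = 2 * b ∸ 1

even : ℕ → ℕ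
even a = 2 * a

even-suc : ∀ k → even (suc k) ≡ suc (suc (2 * k))
even-suc k = cong suc (+-suc k (k + 0))

odd-suc : ∀ k → odd (suc k) ≡ suc (2 * k)
odd-suc k = +-suc k (k + 0)

even%2 : ∀ a → even a % 2 ≡ 0
even%2 a = trans (cong (_% 2) (*-comm 2 a)) (m*n%n≡0 a 2)

odd%2 : ∀ b → 1 ≤ b → odd b % 2 ≡ 1
odd%2 (suc k) _ = begin
  odd (suc k) % 2   ≡⟨ cong (_% 2) (odd-suc k) ⟩
  suc (2 * k) % 2   ≡⟨ cong (λ z → suc z % 2) (*-comm 2 k) ⟩
  (1 + k * 2) % 2   ≡⟨ [m+kn]%n≡m%n 1 k 2 ⟩
  1                 ∎
  where open ≡-Reasoning

even-≢-odd : ∀ a b → 1 ≤ b → even a ≢ odd b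
even-≢-odd a (suc k) _ eq = even≢odd a k (trans eq (odd-suc k))

even-injective : ∀ a b → even a ≡ even b → a ≡ b
even-injective a b = *-cancelˡ-≡ a b 2

odd-injective : ∀ a b → 1 ≤ a → 1 ≤ b → odd a ≡ odd b → a ≡ b
odd-injective (suc j) (suc k) _ _ eq =
  cong suc (even-injective j k (suc-injective (trans (sym (odd-suc j)) (trans eq (odd-suc k)))))

odd<even : ∀ a → 1 ≤ a → odd a < even a
odd<even (suc k) _ rewrite odd-suc k = n<1+n _

odd-mono-< : ∀ a b → 1 ≤ a → a < b → odd a < odd b
odd-mono-< (suc j) (suc k) _ (s≤s j<k) rewrite odd-suc j | odd-suc k = s≤s (*-monoʳ-< 2 j<k)

swap-left : ∀ a b → swap a b a ≡ b
swap-left a b rewrite dec-true (a ≟ a) refl = refl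

swap-right : ∀ a b → swap a b b ≡ a
swap-right a b with b ≟ a
... | yes b≡a rewrite dec-true (b ≟ a) b≡a = b≡a
... | no b≢a rewrite dec-false (b ≟ a) b≢a | dec-true (b ≟ b) refl = refl

swap-other : ∀ a b x → x ≢ a → x ≢ b → swap a b x ≡ x
swap-other a b x x≢a x≢b rewrite dec-false (x ≟ a) x≢a | dec-false (x ≟ b) x≢b = refl

swap-involutive : ∀ a b x → swap a b (swap a b x) ≡ x
swap-involutive a b x with x ≟ a
... | yes x≡a rewrite dec-true (x ≟ a) x≡a = trans (swap-right a b) (sym x≡a)
... | no x≢a with x ≟ b
...   | yes x≡b rewrite dec-false (x ≟ a) x≢a | dec-true (x ≟ b) x≡b = trans (swap-left a b) (sym x≡b)
...   | no x≢b rewrite swap-other a b x x≢a x≢b = swap-other a b x x≢a x≢b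

τ-involutive : ∀ e x → τ e (τ e x) ≡ x
τ-involutive (a , b) = swap-involutive (2 * a) (2 * b ∸ 1)

τ-even-hit : ∀ a v → τ (a , v) (even a) ≡ odd v
τ-even-hit a v = swap-left (2 * a) (2 * v ∸ 1)

τ-odd-hit : ∀ u b → τ (u , b) (odd b) ≡ even u
τ-odd-hit u b = swap-right (2 * u) (2 * b ∸ 1)

τ-even-miss : ∀ u v a → u ≢ a → 1 ≤ v → τ (u , v) (even a) ≡ even a
τ-even-miss u v a u≢a 1≤v = swap-other (2 * u) (2 * v ∸ 1) (2 * a)
  (λ eq → u≢a (even-injective u a (sym eq))) (even-≢-odd a v 1≤v)

τ-odd-miss : ∀ u v b → v ≢ b → 1 ≤ v → 1 ≤ b → τ (u , v) (odd b) ≡ odd b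
τ-odd-miss u v b v≢b 1≤v 1≤b = swap-other (2 * u) (2 * v ∸ 1) (2 * b ∸ 1)
  (λ eq → even-≢-odd u b 1≤b (sym eq)) (λ eq → v≢b (odd-injective v b 1≤v 1≤b (sym eq)))

applyAfter-∷ʳ : ∀ es e x → applyAfter (es ∷ʳ e) x ≡ τ e (applyAfter es x)
applyAfter-∷ʳ []       e x = refl
applyAfter-∷ʳ (f ∷ es) e x = applyAfter-∷ʳ es e (τ f x)

π₀-involutive : ∀ p → π₀ (π₀ p) ≡ p
π₀-involutive zero = refl
π₀-involutive (suc zero) = refl
π₀-involutive (suc (suc zero)) = refl
π₀-involutive (suc (suc (suc k))) with π₀ (suc k) | π₀-involutive (suc k)
... | suc m | π₀m≡k = cong (λ z → suc (suc z)) π₀m≡k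

π₀-2k+1 : ∀ k → π₀ (suc (2 * k)) ≡ suc (suc (2 * k))
π₀-2k+1 zero = refl
π₀-2k+1 (suc j) rewrite even-suc j = cong (λ z → suc (suc z)) (π₀-2k+1 j)

π₀-2k+2 : ∀ k → π₀ (suc (suc (2 * k))) ≡ suc (2 * k)
π₀-2k+2 zero = refl
π₀-2k+2 (suc j) rewrite even-suc j = cong (λ z → suc (suc z)) (π₀-2k+2 j)

π₀-even : ∀ a → 1 ≤ a → π₀ (even a) ≡ odd a
π₀-even (suc k) _ = trans (cong π₀ (even-suc k)) (trans (π₀-2k+2 k) (sym (odd-suc k)))

π₀-odd : ∀ b → 1 ≤ b → π₀ (odd b) ≡ even b
π₀-odd (suc k) _ = trans (cong π₀ (odd-suc k)) (trans (π₀-2k+1 k) (sym (even-suc k)))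

π₀-preimage : ∀ p {s} → π₀ p ≡ s → p ≡ π₀ s
π₀-preimage p eq = trans (sym (π₀-involutive p)) (cong π₀ eq)

∈-∷ʳ⁻ : ∀ {A : Set} {xs : List A} {x y} → y ∈ xs ∷ʳ x → y ≢ x → y ∈ xs
∈-∷ʳ⁻ {xs = xs} y∈ y≢x with ∈-++⁻ xs y∈
... | inj₁ y∈xs = y∈xs
... | inj₂ (here y≡x) = ⊥-elim (y≢x y≡x)

AllPairs-∷ʳ⁻ : ∀ {A : Set} {R : A → A → Set} {xs : List A} {x} →
               AllPairs R (xs ∷ʳ x) → AllPairs R xs × All (λ y → R y x) xs
AllPairs-∷ʳ⁻ {xs = []}     _          = [] , []
AllPairs-∷ʳ⁻ {xs = y ∷ xs} (Ry ∷ Rxs) with AllPairs-∷ʳ⁻ Rxs | ++⁻ʳ xs Ry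
... | Rxs′ , Rxsx | Ryx ∷ [] = (++⁻ˡ xs Ry ∷ Rxs′) , (Ryx ∷ Rxsx)

terrainLike-init : ∀ xs e → (∀ f → f ∈ xs → ¬ (f ⪯ e)) →
                   TerrainLike (xs ∷ʳ e) → TerrainLike xs
terrainLike-init xs e minimal terrain a b c d a<b b<c c<d ac∈ bd∈ =
  ∈-∷ʳ⁻ (terrain a b c d a<b b<c c<d (∈-++⁺ˡ ac∈) (∈-++⁺ˡ bd∈))
    (λ { refl → minimal (a , c) ac∈ (≤-refl , <⇒≤ c<d) })

Π-init : ∀ es e p {s} → Π (es ∷ʳ e) p ≡ s → Π es p ≡ τ e s
Π-init es e p eq =
  trans (sym (τ-involutive e _)) (cong (τ e) (trans (sym (applyAfter-∷ʳ es e (π₀ p))) eq))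

NonEdgeOrder : ℕ → ℕ → Set
NonEdgeOrder p q = ¬ ((p < q) ⇔ (p % 2 ≡ q % 2))

-- A sufficient condition for the positions p, q with Π rs p ≡ s and Π rs q ≡ t
-- to be in non-edge order, stable under removing the last edge of rs.
data State (rs : List Edge) : ℕ → ℕ → Set where
  even-odd  : ∀ {α β} → 1 ≤ α → α < β →
              (∀ f → f ∈ rs → ¬ (f ⪯ (α , β))) →
              State rs (even α) (odd β)
  odd-odd   : ∀ {a b} → 1 ≤ b → b < a →
              (∀ w → (w , a) ∈ rs → w < b) →
              (∀ w → (w , b) ∈ rs → (w , a) ∈ rs) →
              State rs (odd a) (odd b)
  even-even : ∀ {a b} → 1 ≤ b → b < a →
              (∀ w → (b , w) ∈ rs → a < w) →
              (∀ w → (a , w) ∈ rs → (b , w) ∈ rs) →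
              State rs (even a) (even b)
  odd-even  : ∀ {a b} c → 1 ≤ b → b < c → c < a → (b , a) ∈ rs →
              (∀ w → (w , a) ∈ rs → w < c) →
              (∀ w → (b , w) ∈ rs → c < w) →
              State rs (odd a) (even b)

module Peel (xs : List Edge) {u v : ℕ} (1≤u : 1 ≤ u) (u<v : u < v)
            (minimal : ∀ f → f ∈ xs → ¬ (f ⪯ (u , v)))
            (terrain : TerrainLike (xs ∷ʳ (u , v))) where

  E : List Edge
  E = xs ∷ʳ (u , v)

  1≤v : 1 ≤ v
  1≤v = ≤-trans 1≤u (<⇒≤ u<v)

  uv∈E : (u , v) ∈ E
  uv∈E = ∈-++⁺ʳ xs (here refl)

  ∈E⁻ˡ : ∀ {a b} → (a , b) ∈ E → a ≢ u → (a , b) ∈ xs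
  ∈E⁻ˡ ab∈ a≢u = ∈-∷ʳ⁻ ab∈ (λ eq → a≢u (cong proj₁ eq))

  ∈E⁻ʳ : ∀ {a b} → (a , b) ∈ E → b ≢ v → (a , b) ∈ xs
  ∈E⁻ʳ ab∈ b≢v = ∈-∷ʳ⁻ ab∈ (λ eq → b≢v (cong proj₂ eq))

  w<u : ∀ {w} → (w , v) ∈ xs → w < u
  w<u wv∈ = ≰⇒> (λ u≤w → minimal _ wv∈ (u≤w , ≤-refl))

  v<w : ∀ {w} → (u , w) ∈ xs → v < w
  v<w uw∈ = ≰⇒> (λ w≤v → minimal _ uw∈ (≤-refl , w≤v))

  crossing-left : ∀ {w b} → w < u → u < b → b < v → (w , b) ∈ xs → (w , v) ∈ xs
  crossing-left {w} {b} w<u u<b b<v wb∈ =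
    ∈E⁻ˡ (terrain w u b v w<u u<b b<v (∈-++⁺ˡ wb∈) uv∈E) (<⇒≢ w<u)

  crossing-right : ∀ {a w} → u < a → a < v → v < w → (a , w) ∈ xs → (u , w) ∈ xs
  crossing-right {a} {w} u<a a<v v<w aw∈ =
    ∈E⁻ʳ (terrain u a v w u<a a<v v<w uv∈E (∈-++⁺ˡ aw∈)) (≢-sym (<⇒≢ v<w))

  step-even-odd : ∀ {α β} → 1 ≤ α → α < β → (∀ f → f ∈ E → ¬ (f ⪯ (α , β))) →
                  State xs (τ (u , v) (even α)) (τ (u , v) (odd β))
  step-even-odd {α} {β} 1≤α α<β below with u ≟ α | v ≟ β
  ... | yes refl | yes refl = ⊥-elim (below (u , v) uv∈E (≤-refl , ≤-refl))
  ... | yes refl | no v≢β =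
    subst₂ (State xs) (sym (τ-even-hit u v)) (sym (τ-odd-miss u v β v≢β 1≤v 1≤β))
      (odd-odd 1≤β β<v (λ w wv∈ → <-trans (w<u wv∈) α<β) wβ⇒wv)
    where
    1≤β : 1 ≤ β
    1≤β = ≤-trans 1≤α (<⇒≤ α<β)
    β<v : β < v
    β<v = ≰⇒> (λ v≤β → below (u , v) uv∈E (≤-refl , v≤β))
    wβ⇒wv : ∀ w → (w , β) ∈ xs → (w , v) ∈ xs
    wβ⇒wv w wβ∈ with ≤-<-connex u w
    ... | inj₁ u≤w = ⊥-elim (below (w , β) (∈-++⁺ˡ wβ∈) (u≤w , ≤-refl))
    ... | inj₂ w<u = crossing-left w<u α<β β<v wβ∈
  ... | no u≢α | yes refl =
    subst₂ (State xs) (sym (τ-even-miss u v α u≢α 1≤v)) (sym (τ-odd-hit u v))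
      (even-even 1≤u u<α (λ w uw∈ → <-trans α<β (v<w uw∈)) αw⇒uw)
    where
    u<α : u < α
    u<α = ≰⇒> (λ α≤u → below (u , v) uv∈E (α≤u , ≤-refl))
    αw⇒uw : ∀ w → (α , w) ∈ xs → (u , w) ∈ xs
    αw⇒uw w αw∈ with ≤-<-connex w v
    ... | inj₁ w≤v = ⊥-elim (below (α , w) (∈-++⁺ˡ αw∈) (≤-refl , w≤v))
    ... | inj₂ v<w = crossing-right u<α α<β v<w αw∈
  ... | no u≢α | no v≢β =
    subst₂ (State xs) (sym (τ-even-miss u v α u≢α 1≤v)) (sym (τ-odd-miss u v β v≢β 1≤v 1≤β))
      (even-odd 1≤α α<β (λ f f∈ → below f (∈-++⁺ˡ f∈)))
    where
    1≤β : 1 ≤ β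
    1≤β = ≤-trans 1≤α (<⇒≤ α<β)

  step-odd-odd : ∀ {a b} → 1 ≤ b → b < a →
                 (∀ w → (w , a) ∈ E → w < b) → (∀ w → (w , b) ∈ E → (w , a) ∈ E) →
                 State xs (τ (u , v) (odd a)) (τ (u , v) (odd b))
  step-odd-odd {a} {b} 1≤b b<a left< wb⇒wa with v ≟ a | v ≟ b
  ... | yes refl | yes refl = ⊥-elim (<-irrefl refl b<a)
  ... | yes refl | no v≢b =
    subst₂ (State xs) (sym (τ-odd-hit u v)) (sym (τ-odd-miss u v b v≢b 1≤v 1≤b))
      (even-odd 1≤u (left< u uv∈E)
        (λ f f∈ (u≤f₁ , f₂≤b) → minimal f f∈ (u≤f₁ , ≤-trans f₂≤b (<⇒≤ b<a))))
  ... | no v≢a | yes refl =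
    subst₂ (State xs) (sym (τ-odd-miss u v a v≢a 1≤v 1≤a)) (sym (τ-odd-hit u v))
      (odd-even v 1≤u u<v b<a (∈E⁻ʳ (wb⇒wa u uv∈E) (≢-sym v≢a))
        (λ w wa∈ → left< w (∈-++⁺ˡ wa∈)) (λ w → v<w))
    where
    1≤a : 1 ≤ a
    1≤a = ≤-trans 1≤b (<⇒≤ b<a)
  ... | no v≢a | no v≢b =
    subst₂ (State xs) (sym (τ-odd-miss u v a v≢a 1≤v 1≤a)) (sym (τ-odd-miss u v b v≢b 1≤v 1≤b))
      (odd-odd 1≤b b<a (λ w wa∈ → left< w (∈-++⁺ˡ wa∈))
        (λ w wb∈ → ∈E⁻ʳ (wb⇒wa w (∈-++⁺ˡ wb∈)) (≢-sym v≢a)))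
    where
    1≤a : 1 ≤ a
    1≤a = ≤-trans 1≤b (<⇒≤ b<a)

  step-even-even : ∀ {a b} → 1 ≤ b → b < a →
                   (∀ w → (b , w) ∈ E → a < w) → (∀ w → (a , w) ∈ E → (b , w) ∈ E) →
                   State xs (τ (u , v) (even a)) (τ (u , v) (even b))
  step-even-even {a} {b} 1≤b b<a right> aw⇒bw with u ≟ a | u ≟ b
  ... | yes refl | yes refl = ⊥-elim (<-irrefl refl b<a)
  ... | yes refl | no u≢b =
    subst₂ (State xs) (sym (τ-even-hit u v)) (sym (τ-even-miss u v b u≢b 1≤v))
      (odd-even u 1≤b b<a u<v (∈E⁻ˡ (aw⇒bw v uv∈E) (≢-sym u≢b))
        (λ w → w<u) (λ w bw∈ → right> w (∈-++⁺ˡ bw∈)))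
  ... | no u≢a | yes refl =
    subst₂ (State xs) (sym (τ-even-miss u v a u≢a 1≤v)) (sym (τ-even-hit u v))
      (even-odd (≤-trans 1≤b (<⇒≤ b<a)) (right> v uv∈E)
        (λ f f∈ (a≤f₁ , f₂≤v) → minimal f f∈ (≤-trans (<⇒≤ b<a) a≤f₁ , f₂≤v)))
  ... | no u≢a | no u≢b =
    subst₂ (State xs) (sym (τ-even-miss u v a u≢a 1≤v)) (sym (τ-even-miss u v b u≢b 1≤v))
      (even-even 1≤b b<a (λ w bw∈ → right> w (∈-++⁺ˡ bw∈))
        (λ w aw∈ → ∈E⁻ˡ (aw⇒bw w (∈-++⁺ˡ aw∈)) (≢-sym u≢b)))

  step-odd-even : ∀ {a b} c → 1 ≤ b → b < c → c < a → (b , a) ∈ E →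
                  (∀ w → (w , a) ∈ E → w < c) → (∀ w → (b , w) ∈ E → c < w) →
                  State xs (τ (u , v) (odd a)) (τ (u , v) (even b))
  step-odd-even {a} {b} c 1≤b b<c c<a ba∈ left< right> with v ≟ a | u ≟ b
  ... | yes refl | yes refl =
    subst₂ (State xs) (sym (τ-odd-hit u v)) (sym (τ-even-hit u v))
      (even-odd 1≤u u<v minimal)
  ... | yes refl | no u≢b =
    subst₂ (State xs) (sym (τ-odd-hit u v)) (sym (τ-even-miss u v b u≢b 1≤v))
      (even-even 1≤b b<u (λ w bw∈ → <-trans (left< u uv∈E) (right> w (∈-++⁺ˡ bw∈))) uw⇒bw)
    where
    bv∈ : (b , v) ∈ xs
    bv∈ = ∈E⁻ˡ ba∈ (≢-sym u≢b)
    b<u : b < u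
    b<u = w<u bv∈
    uw⇒bw : ∀ w → (u , w) ∈ xs → (b , w) ∈ xs
    uw⇒bw w uw∈ = ∈E⁻ˡ (terrain b u v w b<u u<v (v<w uw∈) ba∈ (∈-++⁺ˡ uw∈)) (<⇒≢ b<u)
  ... | no v≢a | yes refl =
    subst₂ (State xs) (sym (τ-odd-miss u v a v≢a 1≤v 1≤a)) (sym (τ-even-hit u v))
      (odd-odd 1≤v v<a (λ w wa∈ → <-trans (left< w (∈-++⁺ˡ wa∈)) (right> v uv∈E)) wv⇒wa)
    where
    1≤a : 1 ≤ a
    1≤a = ≤-trans 1≤u (<⇒≤ (<-trans b<c c<a))
    ua∈ : (u , a) ∈ xs
    ua∈ = ∈E⁻ʳ ba∈ (≢-sym v≢a)
    v<a : v < a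
    v<a = v<w ua∈
    wv⇒wa : ∀ w → (w , v) ∈ xs → (w , a) ∈ xs
    wv⇒wa w wv∈ = ∈E⁻ˡ (terrain w u v a (w<u wv∈) u<v v<a (∈-++⁺ˡ wv∈) ba∈) (<⇒≢ (w<u wv∈))
  ... | no v≢a | no u≢b =
    subst₂ (State xs) (sym (τ-odd-miss u v a v≢a 1≤v 1≤a)) (sym (τ-even-miss u v b u≢b 1≤v))
      (odd-even c 1≤b b<c c<a (∈E⁻ˡ ba∈ (≢-sym u≢b))
        (λ w wa∈ → left< w (∈-++⁺ˡ wa∈)) (λ w bw∈ → right> w (∈-++⁺ˡ bw∈)))
    where
    1≤a : 1 ≤ a
    1≤a = ≤-trans 1≤b (<⇒≤ (<-trans b<c c<a))

  step : ∀ {s t} → State E s t → State xs (τ (u , v) s) (τ (u , v) t)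
  step (even-odd 1≤α α<β below) = step-even-odd 1≤α α<β below
  step (odd-odd 1≤b b<a left< wb⇒wa) = step-odd-odd 1≤b b<a left< wb⇒wa
  step (even-even 1≤b b<a right> aw⇒bw) = step-even-even 1≤b b<a right> aw⇒bw
  step (odd-even c 1≤b b<c c<a ba∈ left< right>) = step-odd-even c 1≤b b<c c<a ba∈ left< right>

ascending-with-opposite-parity : ∀ {p q} → p < q → p % 2 ≢ q % 2 → NonEdgeOrder p q
ascending-with-opposite-parity p<q p≢q p<q⇔ = p≢q (Equivalence.to p<q⇔ p<q)

descending-with-same-parity : ∀ {p q} → q < p → p % 2 ≡ q % 2 → NonEdgeOrder p q
descending-with-same-parity q<p p≡q p<q⇔ = <-asym (Equivalence.from p<q⇔ p≡q) q<p

State-[]⇒NonEdgeOrder : ∀ {s t} → State [] s t → NonEdgeOrder (π₀ s) (π₀ t)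
State-[]⇒NonEdgeOrder (even-odd {α} {β} 1≤α α<β _) =
  subst₂ NonEdgeOrder (sym (π₀-even α 1≤α)) (sym (π₀-odd β 1≤β))
    (ascending-with-opposite-parity (<-≤-trans (odd<even α 1≤α) (*-monoʳ-≤ 2 (<⇒≤ α<β)))
      (λ eq → 1+n≢0 (trans (sym (odd%2 α 1≤α)) (trans eq (even%2 β)))))
  where
  1≤β : 1 ≤ β
  1≤β = ≤-trans 1≤α (<⇒≤ α<β)
State-[]⇒NonEdgeOrder (odd-odd {a} {b} 1≤b b<a _ _) =
  subst₂ NonEdgeOrder (sym (π₀-odd a 1≤a)) (sym (π₀-odd b 1≤b))
    (descending-with-same-parity (*-monoʳ-< 2 b<a) (trans (even%2 a) (sym (even%2 b))))
  where
  1≤a : 1 ≤ a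
  1≤a = ≤-trans 1≤b (<⇒≤ b<a)
State-[]⇒NonEdgeOrder (even-even {a} {b} 1≤b b<a _ _) =
  subst₂ NonEdgeOrder (sym (π₀-even a 1≤a)) (sym (π₀-even b 1≤b))
    (descending-with-same-parity (odd-mono-< b a 1≤b b<a) (trans (odd%2 a 1≤a) (sym (odd%2 b 1≤b))))
  where
  1≤a : 1 ≤ a
  1≤a = ≤-trans 1≤b (<⇒≤ b<a)
State-[]⇒NonEdgeOrder (odd-even _ _ _ _ () _ _)

State⇒NonEdgeOrder : ∀ {n es} → Reverse es → All (WellFormedEdge n) es → TerrainLike es →
                     ValidDecreasing es → ∀ {s t p q} → State es s t →
                     Π es p ≡ s → Π es q ≡ t → NonEdgeOrder p q
State⇒NonEdgeOrder [] _ _ _ {p = p} {q = q} st p↦ q↦ =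
  subst₂ NonEdgeOrder (sym (π₀-preimage p p↦)) (sym (π₀-preimage q q↦)) (State-[]⇒NonEdgeOrder st)
State⇒NonEdgeOrder (xs ∶ xs-view ∶ʳ (u , v)) wf terrain valid {p = p} {q = q} st p↦ q↦
  with ++⁻ xs wf | AllPairs-∷ʳ⁻ valid
... | wf-xs , (1≤u , u<v , _) ∷ [] | valid-xs , uv-minimal =
  State⇒NonEdgeOrder xs-view wf-xs (terrainLike-init xs (u , v) minimal terrain) valid-xs
    (Peel.step xs 1≤u u<v minimal terrain st)
    (Π-init xs (u , v) p p↦) (Π-init xs (u , v) q q↦)
  where
  minimal : ∀ f → f ∈ xs → ¬ (f ⪯ (u , v))
  minimal f = All.lookup uv-minimal

mainTheorem8 : (n : ℕ) (es : List Edge) →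
    All (WellFormedEdge n) es →
    TerrainLike es →
    ValidDecreasing es →
    (x y : ℕ) → 1 ≤ x → x < y → y ≤ n →
    (∀ u v → (u , v) ∈ es → ¬ ((u , v) ⪯ (x , y))) →
    NonEdgeConfig n (Π es) (2 * x) (2 * y ∸ 1)
mainTheorem8 n es wf terrain valid x y 1≤x x<y _ nothing-below p q _ _ _ _ =
  State⇒NonEdgeOrder (reverseView es) wf terrain valid
    (even-odd 1≤x x<y (λ { (u , v) → nothing-below u v }))
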